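{- Let $s\ge1$, $m\ge0$ and $\mathbf m=(m_1,\dots,m_s)\in\mathbb N_0^s$ be such that every box $I$ of the $\mathbf m$-partition $\mathcal P_{\mathbf m}$ satisfies $|I|\le m+2$. Then \[F^m=\sum_{I\in\mathcal P_{\mathbf m}}F^{m-|I|}.\]
   Context: Let $\varphi=(1+\sqrt5)/2$, $F_0=0$, $F_1=1$, $F_k=F_{k-1}+F_{k-2}$, and $F^m:=F_{m+2}$ for $m\ge-2$. Every $n\in\mathbb N_0$ has a unique Zeckendorf expansion $n=\sum_jd_jF^j$ with $d_j\in\{0,1\}$ and no two consecutive $1$'s; put $\overline n=\sum_jd_j\varphi^j$ and $|n|:=d_0$. The $\mathbf m$-partition $\mathcal P_{\mathbf m}$ of $[0,1)^s$ consists of all boxes $I=\prod_{j=1}^s[\overline{a_j}/\varphi^{m_j},\overline{a_j+1}/\varphi^{m_j})$ with $0\le a_j<F^{m_j}$, and for such $I$, $|I|:=\sum_{j=1}^s(m_j+|a_j|)$. -}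

module Defs where

open import Data.Nat using (ℕ; zero; suc; _+_; _<_)
open import Data.Bool using (Bool; true; false; if_then_else_)
open import Data.List using (List; []; _∷_)
open import Data.Vec using (Vec; []; _∷_)
open import Data.Unit using (⊤)
open import Data.Empty using (⊥)
open import Relation.Binary.PropositionalEquality using (_≡_)

fib : ℕ → ℕ
fib zero = zero
fib (suc zero) = suc zero
fib (suc (suc k)) = fib (suc k) + fib k

-- F^m := F_{m+2}  (for m ≥ 0; negative upper indices are handled via fib directly)
Fup : ℕ → ℕ
Fup m = fib (m + 2)

-- A Zeckendorf digit list d_0 d_1 d_2 ... (least significant first).
-- Value: Σ_j d_j F^j  where F^j = fib (j + 2).
valFrom : ℕ → List Bool → ℕ
valFrom k [] = 0
valFrom k (b ∷ bs) = (if b then Fup k else 0) + valFrom (suc k) bs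

zval : List Bool → ℕ
zval = valFrom 0

NoAdj : List Bool → Set
NoAdj [] = ⊤
NoAdj (true ∷ true ∷ bs) = ⊥
NoAdj (b ∷ bs) = NoAdj bs

IsZeckendorf : List Bool → ℕ → Set
IsZeckendorf ds n = NoAdj ds × (zval ds ≡ n)
  where open import Data.Product using (_×_)

digit0 : List Bool → ℕ
digit0 [] = 0
digit0 (true ∷ _) = 1
digit0 (false ∷ _) = 0

sumRange : ℕ → (ℕ → ℕ) → ℕ
sumRange zero f = 0
sumRange (suc N) f = sumRange N f + f N

-- Sum over all boxes of the m-partition, a box being indexed by a tuple
-- (a_1,...,a_s) with 0 ≤ a_j < F^{m_j}.
sumBoxes : ∀ {s} → Vec ℕ s → (Vec ℕ s → ℕ) → ℕ
sumBoxes [] f = f []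
sumBoxes (m ∷ ms) f = sumRange (Fup m) (λ a → sumBoxes ms (λ as → f (a ∷ as)))

data InPartition : ∀ {s} → Vec ℕ s → Vec ℕ s → Set where
  []  : InPartition [] []
  _∷_ : ∀ {s m a} {ms as : Vec ℕ s} → a < Fup m → InPartition ms as → InPartition (m ∷ ms) (a ∷ as)

boxNorm : (ℕ → List Bool) → ∀ {s} → Vec ℕ s → Vec ℕ s → ℕ
boxNorm zeck [] [] = 0
boxNorm zeck (m ∷ ms) (a ∷ as) = m + digit0 (zeck a) + boxNorm zeck ms as

-- Write |a| for the lowest Zeckendorf digit of a.  Prefixing the digits 0 1 above an expansion
-- of b < F^n gives one of F^{n+1} + b, so |F^{n+1} + b| = |b|; hence among a < F^k exactly
-- F_{k+1} have |a| = 0 and F_k have |a| = 1.  For any M bounding all box norms,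
-- Σ_I F_{M-|I|} = F_M by induction on s: once the other coordinates are summed out, the first
-- one contributes F_{k+1} F_{M-k} + F_k F_{M-k-1}, which is F_M by the Fibonacci addition
-- formula.  That |a| does not depend on the chosen expansion follows by padding two expansions
-- to equal length and comparing their top digits.
module Submission where

open import Defs
open import Data.Nat using (ℕ; zero; suc; _+_; _*_; _∸_; _≤_; _<_; _≤′_; ≤′-refl; ≤′-step; z≤n; s≤s)
open import Data.Nat.Properties
open import Data.Nat.Solver using (module +-*-Solver)
open import Data.Bool using (Bool; true; false; if_then_else_)
open import Data.List using (List; []; _∷_; _++_; _∷ʳ_; length)
open import Data.List.Properties using (length-++; ++-identityʳ)
open import Data.List.Reverse using (Reverse; []; _∶_∶ʳ_; reverseView)
open import Data.Vec using (Vec; []; _∷_; replicate)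
open import Data.Product using (_,_; proj₁; proj₂)
open import Data.Unit using (tt)
open import Function using (_∘_)
open import Relation.Binary.PropositionalEquality
  using (_≡_; refl; sym; trans; cong; cong₂; subst; module ≡-Reasoning)
open import Relation.Nullary using (contradiction)

open +-*-Solver

fib-≤-suc : ∀ n → fib n ≤ fib (suc n)
fib-≤-suc zero = z≤n
fib-≤-suc (suc n) = m≤m+n (fib (suc n)) (fib n)

fib-mono : ∀ {m n} → m ≤ n → fib m ≤ fib n
fib-mono = go ∘ ≤⇒≤′
  where
  go : ∀ {m n} → m ≤′ n → fib m ≤ fib n
  go ≤′-refl = ≤-refl
  go (≤′-step {n} p) = ≤-trans (go p) (fib-≤-suc n)

Fup≡fib : ∀ k → Fup k ≡ fib (suc (suc k))
Fup≡fib k = cong fib (+-comm k 2)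

Fup-mono : ∀ {m n} → m ≤ n → Fup m ≤ Fup n
Fup-mono p = fib-mono (+-monoˡ-≤ 2 p)

Fup-pos : ∀ k → 0 < Fup k
Fup-pos k = Fup-mono {0} {k} z≤n

*-+-recombine : ∀ a b c d e → (a * d + b * e) + (b * d + c * e) ≡ (a + b) * d + (b + c) * e
*-+-recombine = solve 5 (λ a b c d e → (a :* d :+ b :* e) :+ (b :* d :+ c :* e) := (a :+ b) :* d :+ (b :+ c) :* e) refl

fib-+ : ∀ k t → fib (k + suc t) ≡ fib (suc k) * fib (suc t) + fib k * fib t
fib-+ zero t = solve 1 (λ x → x := con 1 :* x :+ con 0 :* x) refl (fib (suc t))
fib-+ (suc zero) t = solve 2 (λ x y → x :+ y := con 1 :* x :+ con 1 :* y) refl (fib (suc t)) (fib t)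
fib-+ (suc (suc k)) t = trans (cong₂ _+_ (fib-+ (suc k) t) (fib-+ k t))
  (*-+-recombine (fib (suc (suc k))) (fib (suc k)) (fib k) (fib (suc t)) (fib t))

fib-∸-split : ∀ k M → (0 < k → k < M) → fib (suc k) * fib (M ∸ k) + fib k * fib (M ∸ suc k) ≡ fib M
fib-∸-split zero M _ = trans (+-identityʳ _) (+-identityʳ (fib M))
fib-∸-split (suc k) M k<M with m≤n⇒∃[o]m+o≡n (k<M (s≤s z≤n))
... | t , refl = begin
  fib (suc (suc k)) * fib (suc (k + t) ∸ k) + fib (suc k) * fib (k + t ∸ k)
    ≡⟨ cong₂ (λ x y → fib (suc (suc k)) * fib x + fib (suc k) * fib y)
             (trans (cong (_∸ k) (sym (+-suc k t))) (m+n∸m≡n k (suc t))) (m+n∸m≡n k t) ⟩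
  fib (suc (suc k)) * fib (suc t) + fib (suc k) * fib t
    ≡⟨ sym (fib-+ (suc k) t) ⟩
  fib (suc (k + suc t))
    ≡⟨ cong (fib ∘ suc) (+-suc k t) ⟩
  fib (suc (suc (k + t))) ∎
  where open ≡-Reasoning

sumRange-cong : ∀ N {f g : ℕ → ℕ} → (∀ a → a < N → f a ≡ g a) → sumRange N f ≡ sumRange N g
sumRange-cong zero f≗g = refl
sumRange-cong (suc N) f≗g = cong₂ _+_ (sumRange-cong N (λ a a<N → f≗g a (m<n⇒m<1+n a<N))) (f≗g N ≤-refl)

sumRange-+ : ∀ A B (f : ℕ → ℕ) → sumRange (A + B) f ≡ sumRange A f + sumRange B (λ b → f (A + b))
sumRange-+ A zero f rewrite +-identityʳ A = sym (+-identityʳ _)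
sumRange-+ A (suc B) f rewrite +-suc A B =
  trans (cong (_+ f (A + B)) (sumRange-+ A B f)) (+-assoc (sumRange A f) _ _)

sumBoxes-cong : ∀ {s} (ms : Vec ℕ s) {f g : Vec ℕ s → ℕ} → (∀ as → f as ≡ g as) → sumBoxes ms f ≡ sumBoxes ms g
sumBoxes-cong [] f≗g = f≗g []
sumBoxes-cong (m ∷ ms) f≗g = sumRange-cong (Fup m) (λ a _ → sumBoxes-cong ms (λ as → f≗g (a ∷ as)))

valFrom-++ : ∀ j xs ys → valFrom j (xs ++ ys) ≡ valFrom j xs + valFrom (j + length xs) ys
valFrom-++ j [] ys rewrite +-identityʳ j = refl
valFrom-++ j (x ∷ xs) ys rewrite valFrom-++ (suc j) xs ys | +-suc j (length xs) =
  sym (+-assoc (if x then Fup j else 0) (valFrom (suc j) xs) _)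

NoAdj-++⁻ˡ : ∀ xs ys → NoAdj (xs ++ ys) → NoAdj xs
NoAdj-++⁻ˡ [] ys _ = tt
NoAdj-++⁻ˡ (false ∷ xs) ys p = NoAdj-++⁻ˡ xs ys p
NoAdj-++⁻ˡ (true ∷ []) ys _ = tt
NoAdj-++⁻ˡ (true ∷ false ∷ xs) ys p = NoAdj-++⁻ˡ xs ys p

NoAdj-++-false∷ : ∀ xs ys → NoAdj xs → NoAdj (false ∷ ys) → NoAdj (xs ++ false ∷ ys)
NoAdj-++-false∷ [] ys _ q = q
NoAdj-++-false∷ (false ∷ xs) ys p q = NoAdj-++-false∷ xs ys p q
NoAdj-++-false∷ (true ∷ []) ys _ q = q
NoAdj-++-false∷ (true ∷ false ∷ xs) ys p q = NoAdj-++-false∷ xs ys p q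

-- The slack F_{j+1} is what lets the induction pass over a digit pair 1 0.
valFrom+fib≤Fup : ∀ j ds → NoAdj ds → valFrom j ds + fib (suc j) ≤ Fup (j + length ds)
valFrom+fib≤Fup j [] _ rewrite +-identityʳ j | Fup≡fib j = fib-≤-suc (suc j)
valFrom+fib≤Fup j (false ∷ ds) p rewrite +-suc j (length ds) =
  ≤-trans (+-monoʳ-≤ (valFrom (suc j) ds) (fib-≤-suc (suc j))) (valFrom+fib≤Fup (suc j) ds p)
valFrom+fib≤Fup j (true ∷ []) _ rewrite +-identityʳ (Fup j) | +-suc j 0 | +-identityʳ j
                                       | Fup≡fib j | Fup≡fib (suc j) = ≤-refl
valFrom+fib≤Fup j (true ∷ false ∷ ds) p rewrite +-suc j (suc (length ds)) | +-suc j (length ds) =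
  subst (_≤ Fup (suc (suc (j + length ds)))) rearrange (valFrom+fib≤Fup (suc (suc j)) ds p)
  where
  rearrange : valFrom (suc (suc j)) ds + fib (suc (suc (suc j)))
            ≡ Fup j + (0 + valFrom (suc (suc j)) ds) + fib (suc j)
  rearrange rewrite Fup≡fib j =
    solve 3 (λ v a b → v :+ (a :+ b) := a :+ v :+ b) refl (valFrom (suc (suc j)) ds) (fib (suc (suc j))) (fib (suc j))

zval<Fup : ∀ ds → NoAdj ds → zval ds < Fup (length ds)
zval<Fup ds p = <-≤-trans (m<m+n (zval ds) (s≤s z≤n)) (valFrom+fib≤Fup 0 ds p)

valFrom<Fup⇒≡0 : ∀ j ds → valFrom j ds < Fup j → valFrom j ds ≡ 0
valFrom<Fup⇒≡0 j [] _ = refl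
valFrom<Fup⇒≡0 j (false ∷ ds) p = valFrom<Fup⇒≡0 (suc j) ds (<-≤-trans p (Fup-mono (n≤1+n j)))
valFrom<Fup⇒≡0 j (true ∷ ds) p = contradiction (m≤m+n (Fup j) _) (<⇒≱ p)

resize : ℕ → List Bool → List Bool
resize zero _ = []
resize (suc n) [] = false ∷ resize n []
resize (suc n) (d ∷ ds) = d ∷ resize n ds

length-resize : ∀ n ds → length (resize n ds) ≡ n
length-resize zero ds = refl
length-resize (suc n) [] = cong suc (length-resize n [])
length-resize (suc n) (d ∷ ds) = cong suc (length-resize n ds)

NoAdj-resize : ∀ n ds → NoAdj ds → NoAdj (resize n ds)
NoAdj-resize zero ds _ = tt
NoAdj-resize (suc n) [] _ = NoAdj-resize n [] tt
NoAdj-resize (suc n) (false ∷ ds) p = NoAdj-resize n ds p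
NoAdj-resize (suc zero) (true ∷ ds) _ = tt
NoAdj-resize (suc (suc n)) (true ∷ []) _ = NoAdj-resize n [] tt
NoAdj-resize (suc (suc n)) (true ∷ false ∷ ds) p = NoAdj-resize n ds p

valFrom-resize : ∀ n j ds → valFrom j ds < Fup (j + n) → valFrom j (resize n ds) ≡ valFrom j ds
valFrom-resize zero j ds p rewrite +-identityʳ j = sym (valFrom<Fup⇒≡0 j ds p)
valFrom-resize (suc n) j [] _ = valFrom-resize n (suc j) [] (Fup-pos (suc j + n))
valFrom-resize (suc n) j (d ∷ ds) p = cong ((if d then Fup j else 0) +_) (valFrom-resize n (suc j) ds tail<)
  where
  tail< : valFrom (suc j) ds < Fup (suc j + n)
  tail< = ≤-<-trans (m≤n+m _ _) (subst (λ k → valFrom j (d ∷ ds) < Fup k) (+-suc j n) p)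

digit0-resize-++ : ∀ n ds ys → digit0 (resize (suc n) ds ++ ys) ≡ digit0 ds
digit0-resize-++ n [] ys = refl
digit0-resize-++ n (true ∷ ds) ys = refl
digit0-resize-++ n (false ∷ ds) ys = refl

length-∷ʳ : ∀ (xs : List Bool) x → length (xs ∷ʳ x) ≡ suc (length xs)
length-∷ʳ xs x = trans (length-++ xs) (+-comm (length xs) 1)

zval-∷ʳ : ∀ xs x → zval (xs ∷ʳ x) ≡ zval xs + valFrom (length xs) (x ∷ [])
zval-∷ʳ xs x = valFrom-++ 0 xs (x ∷ [])

last-digit-unique : ∀ {xs ys} x y → length xs ≡ length ys → NoAdj xs → NoAdj ys →
                    zval (xs ∷ʳ x) ≡ zval (ys ∷ʳ y) → x ≡ y
last-digit-unique true true _ _ _ _ = refl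
last-digit-unique false false _ _ _ _ = refl
last-digit-unique {xs} {ys} true false |xs|≡|ys| _ q e = contradiction top≤zval (<⇒≱ (zval<Fup ys q))
  where
  open ≤-Reasoning
  top≤zval : Fup (length ys) ≤ zval ys
  top≤zval = begin
    Fup (length ys)                  ≡⟨ cong Fup (sym |xs|≡|ys|) ⟩
    Fup (length xs)                  ≤⟨ m≤n+m _ (zval xs) ⟩
    zval xs + Fup (length xs)        ≡⟨ cong (zval xs +_) (sym (+-identityʳ _)) ⟩
    zval xs + (Fup (length xs) + 0)  ≡⟨ sym (zval-∷ʳ xs true) ⟩
    zval (xs ∷ʳ true)                ≡⟨ e ⟩
    zval (ys ∷ʳ false)               ≡⟨ zval-∷ʳ ys false ⟩
    zval ys + 0                      ≡⟨ +-identityʳ _ ⟩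
    zval ys                          ∎
last-digit-unique {xs} {ys} false true |xs|≡|ys| p q e =
  sym (last-digit-unique {ys} {xs} true false (sym |xs|≡|ys|) q p (sym e))

zval-injective : ∀ {xs ys} → length xs ≡ length ys → NoAdj xs → NoAdj ys → zval xs ≡ zval ys → xs ≡ ys
zval-injective {xs} {ys} = go (reverseView xs) (reverseView ys)
  where
  go : ∀ {xs ys} → Reverse xs → Reverse ys →
       length xs ≡ length ys → NoAdj xs → NoAdj ys → zval xs ≡ zval ys → xs ≡ ys
  go [] [] _ _ _ _ = refl
  go [] (ys ∶ _ ∶ʳ y) eq _ _ _ = contradiction (trans eq (length-∷ʳ ys y)) 0≢1+n
  go (xs ∶ _ ∶ʳ x) [] eq _ _ _ = contradiction (trans (sym eq) (length-∷ʳ xs x)) 0≢1+n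
  go (xs ∶ rxs ∶ʳ x) (ys ∶ rys ∶ʳ y) eq p q e
    with |xs|≡|ys| ← suc-injective (trans (sym (length-∷ʳ xs x)) (trans eq (length-∷ʳ ys y)))
       | p′ ← NoAdj-++⁻ˡ xs _ p | q′ ← NoAdj-++⁻ˡ ys _ q
    with refl ← last-digit-unique {xs} {ys} x y |xs|≡|ys| p′ q′ e
    = cong (_∷ʳ x) (go rxs rys |xs|≡|ys| p′ q′ (+-cancelʳ-≡ _ _ _ prefix))
    where
    open ≡-Reasoning
    prefix : zval xs + valFrom (length ys) (x ∷ []) ≡ zval ys + valFrom (length ys) (x ∷ [])
    prefix = begin
      zval xs + valFrom (length ys) (x ∷ []) ≡⟨ cong (λ l → zval xs + valFrom l (x ∷ [])) (sym |xs|≡|ys|) ⟩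
      zval xs + valFrom (length xs) (x ∷ []) ≡⟨ sym (zval-∷ʳ xs x) ⟩
      zval (xs ∷ʳ x)                         ≡⟨ e ⟩
      zval (ys ∷ʳ x)                         ≡⟨ zval-∷ʳ ys x ⟩
      zval ys + valFrom (length ys) (x ∷ []) ∎

digit0-unique : ∀ xs ys → NoAdj xs → NoAdj ys → zval xs ≡ zval ys → digit0 xs ≡ digit0 ys
digit0-unique xs ys p q e = begin
  digit0 xs                    ≡⟨ sym (digit0-resize xs) ⟩
  digit0 (resize (suc N) xs)   ≡⟨ cong digit0 (zval-injective |xs′|≡|ys′| (NoAdj-resize (suc N) xs p)
                                                 (NoAdj-resize (suc N) ys q) zval-xs′≡zval-ys′) ⟩
  digit0 (resize (suc N) ys)   ≡⟨ digit0-resize ys ⟩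
  digit0 ys                    ∎
  where
  open ≡-Reasoning
  N = length xs + length ys
  digit0-resize : ∀ ds → digit0 (resize (suc N) ds) ≡ digit0 ds
  digit0-resize ds = trans (cong digit0 (sym (++-identityʳ _))) (digit0-resize-++ N ds [])
  |xs′|≡|ys′| : length (resize (suc N) xs) ≡ length (resize (suc N) ys)
  |xs′|≡|ys′| = trans (length-resize (suc N) xs) (sym (length-resize (suc N) ys))
  zval-resize : ∀ ds → NoAdj ds → length ds ≤ N → zval (resize (suc N) ds) ≡ zval ds
  zval-resize ds r |ds|≤N = valFrom-resize (suc N) 0 ds (<-≤-trans (zval<Fup ds r) (Fup-mono (m≤n⇒m≤1+n |ds|≤N)))
  zval-xs′≡zval-ys′ : zval (resize (suc N) xs) ≡ zval (resize (suc N) ys)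
  zval-xs′≡zval-ys′ = trans (zval-resize xs p (m≤m+n _ _))
                        (trans e (sym (zval-resize ys q (m≤n+m _ _))))

replicate-InPartition : ∀ {s} (ms : Vec ℕ s) → InPartition ms (replicate s 0)
replicate-InPartition [] = []
replicate-InPartition (m ∷ ms) = Fup-pos m ∷ replicate-InPartition ms

module _ (zeck : ℕ → List Bool) (zeck-spec : ∀ n → IsZeckendorf (zeck n) n) where

  d₀ : ℕ → ℕ
  d₀ = digit0 ∘ zeck

  d₀-expansion : ∀ {n} ds → NoAdj ds → zval ds ≡ n → d₀ n ≡ digit0 ds
  d₀-expansion {n} ds p e = digit0-unique (zeck n) ds (proj₁ (zeck-spec n)) p (trans (proj₂ (zeck-spec n)) (sym e))

  d₀-0 : d₀ 0 ≡ 0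
  d₀-0 = d₀-expansion [] tt refl

  d₀-1 : d₀ 1 ≡ 1
  d₀-1 = d₀-expansion (true ∷ []) tt refl

  d₀-Fup-+ : ∀ n b → b < Fup n → d₀ (Fup (suc n) + b) ≡ d₀ b
  d₀-Fup-+ zero .0 (s≤s z≤n) = trans (d₀-expansion (false ∷ true ∷ []) tt refl) (sym d₀-0)
  d₀-Fup-+ (suc n) b b<Fup = trans (d₀-expansion shifted no-adj value) (digit0-resize-++ n (zeck b) _)
    where
    open ≡-Reasoning
    padded = resize (suc n) (zeck b)
    shifted = padded ++ false ∷ true ∷ []
    no-adj : NoAdj shifted
    no-adj = NoAdj-++-false∷ padded _ (NoAdj-resize (suc n) (zeck b) (proj₁ (zeck-spec b))) tt
    value : zval shifted ≡ Fup (suc (suc n)) + b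
    value = begin
      zval shifted
        ≡⟨ valFrom-++ 0 padded _ ⟩
      zval padded + valFrom (length padded) (false ∷ true ∷ [])
        ≡⟨ cong₂ (λ v l → v + valFrom l (false ∷ true ∷ []))
                 (valFrom-resize (suc n) 0 (zeck b) (subst (_< Fup (suc n)) (sym (proj₂ (zeck-spec b))) b<Fup))
                 (length-resize (suc n) (zeck b)) ⟩
      zval (zeck b) + (Fup (suc (suc n)) + 0)
        ≡⟨ cong₂ _+_ (proj₂ (zeck-spec b)) (+-identityʳ _) ⟩
      b + Fup (suc (suc n))
        ≡⟨ +-comm b _ ⟩
      Fup (suc (suc n)) + b ∎

  sumRange-d₀ : ∀ (h : ℕ → ℕ) n → sumRange (Fup n) (h ∘ d₀) ≡ fib (suc n) * h 0 + fib n * h 1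
  sumRange-d₀ h zero rewrite d₀-0 = sym (trans (+-identityʳ _) (+-identityʳ _))
  sumRange-d₀ h (suc zero) rewrite d₀-0 | d₀-1 = cong₂ _+_ (sym (+-identityʳ (h 0))) (sym (+-identityʳ (h 1)))
  sumRange-d₀ h (suc (suc n)) = begin
    sumRange (Fup (suc n) + Fup n) (h ∘ d₀)
      ≡⟨ sumRange-+ (Fup (suc n)) (Fup n) (h ∘ d₀) ⟩
    sumRange (Fup (suc n)) (h ∘ d₀) + sumRange (Fup n) (λ b → h (d₀ (Fup (suc n) + b)))
      ≡⟨ cong (sumRange (Fup (suc n)) (h ∘ d₀) +_) (sumRange-cong (Fup n) (λ b b< → cong h (d₀-Fup-+ n b b<))) ⟩
    sumRange (Fup (suc n)) (h ∘ d₀) + sumRange (Fup n) (h ∘ d₀)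
      ≡⟨ cong₂ _+_ (sumRange-d₀ h (suc n)) (sumRange-d₀ h n) ⟩
    (fib (suc (suc n)) * h 0 + fib (suc n) * h 1) + (fib (suc n) * h 0 + fib n * h 1)
      ≡⟨ *-+-recombine (fib (suc (suc n))) (fib (suc n)) (fib n) (h 0) (h 1) ⟩
    fib (suc (suc (suc n))) * h 0 + fib (suc (suc n)) * h 1 ∎
    where open ≡-Reasoning

  sumBoxes-fib∸boxNorm : ∀ {s} (ms : Vec ℕ s) M → (∀ as → InPartition ms as → boxNorm zeck ms as ≤ M) →
                         sumBoxes ms (λ as → fib (M ∸ boxNorm zeck ms as)) ≡ fib M
  sumBoxes-fib∸boxNorm [] M _ = refl
  sumBoxes-fib∸boxNorm (k ∷ ms) M norm≤M = begin
    sumRange (Fup k) (λ a → sumBoxes ms (λ as → fib (M ∸ (k + d₀ a + boxNorm zeck ms as))))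
      ≡⟨ sumRange-cong (Fup k) slice ⟩
    sumRange (Fup k) (λ a → fib (M ∸ (k + d₀ a)))
      ≡⟨ sumRange-d₀ (λ d → fib (M ∸ (k + d))) k ⟩
    fib (suc k) * fib (M ∸ (k + 0)) + fib k * fib (M ∸ (k + 1))
      ≡⟨ cong₂ (λ x y → fib (suc k) * fib (M ∸ x) + fib k * fib (M ∸ y)) (+-identityʳ k) (+-comm k 1) ⟩
    fib (suc k) * fib (M ∸ k) + fib k * fib (M ∸ suc k)
      ≡⟨ fib-∸-split k M k<M ⟩
    fib M ∎
    where
    open ≡-Reasoning
    slice : ∀ a → a < Fup k →
            sumBoxes ms (λ as → fib (M ∸ (k + d₀ a + boxNorm zeck ms as))) ≡ fib (M ∸ (k + d₀ a))
    slice a a<Fup = trans (sumBoxes-cong ms (λ as → cong fib (sym (∸-+-assoc M (k + d₀ a) _))))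
      (sumBoxes-fib∸boxNorm ms (M ∸ (k + d₀ a))
         (λ as as∈ → m+n≤o⇒m≤o∸n _ (subst (_≤ M) (+-comm (k + d₀ a) _) (norm≤M (a ∷ as) (a<Fup ∷ as∈)))))
    -- For k > 0 the box (1, 0, …, 0) exists and has norm k + 1.
    k<M : 0 < k → k < M
    k<M 0<k = ≤-trans (subst (_≤ k + d₀ 1 + boxNorm zeck ms (replicate _ 0)) (trans (cong (k +_) d₀-1) (+-comm k 1)) (m≤m+n _ _))
                      (norm≤M (1 ∷ replicate _ 0) (Fup-mono 0<k ∷ replicate-InPartition ms))

lemma5p5 : (zeck : ℕ → List Bool) → (∀ n → IsZeckendorf (zeck n) n)
    → (s : ℕ) → 1 ≤ s → (m : ℕ) → (ms : Vec ℕ s)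
    → (∀ as → InPartition ms as → boxNorm zeck ms as ≤ m + 2)
    → Fup m ≡ sumBoxes ms (λ as → fib (m + 2 ∸ boxNorm zeck ms as))
lemma5p5 zeck zeck-spec s _ m ms norm≤m+2 = sym (sumBoxes-fib∸boxNorm zeck zeck-spec ms (m + 2) norm≤m+2)
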